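{- Let $S$ be a string of length $n>1$ as described in the context, and let $i\in\{0,\dots,n\}$. For any $j,j'\in\mathcal{P}_i$ we have $\mathcal{L}_j\neq\mathcal{L}_{j'}$ if and only if $j\neq j'$.
   Context: $S$ is a string of length $n>1$ over a totally ordered alphabet $\Sigma$, zero-indexed ($S=S[0]\cdots S[n-1]$), with $S[n-1]=\$$ and $S[k]>\$$ for all $k<n-1$. For $0\le i\le n$, $S_i=S[i]S[i+1]\cdots S[n-1]$ denotes the suffix starting at $i$ ($S_n$ is the empty string). Strings are compared lexicographically ($\prec$), where a proper prefix is smaller than the longer string. A non-empty string is a Lyndon word if it is lexicographically smaller than all its proper suffixes. $\mathcal{L}_i$ denotes the Lyndon prefix of $S_i$, i.e. the longest prefix of $S_i$ that is a Lyndon word. For $i\in\{0,\dots,n-1\}$, $\mathrm{nss}[i]=\min\{j\in\{i+1,\dots,n\}: S_j\prec S_i\}$ (next smaller suffix). For $i\in\{0,\dots,n\}$, $\mathcal{P}_i=\{j\in\{0,\dots,i-1\}:\mathrm{nss}[j]=i\}$. -}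

module Defs where

open import Level using (0ℓ)
open import Data.Nat using (ℕ; zero; suc; _+_; _<_; _≤_)
open import Data.List using (List; []; _∷_; drop; take; length)
open import Data.Product using (∃; _×_)
open import Relation.Binary.Core using (Rel)
open import Relation.Binary.PropositionalEquality using (_≡_)
open import Relation.Nullary using (¬_)

data Lex {A : Set} (_<ₐ_ : Rel A 0ℓ) : List A → List A → Set where
  nil<cons : ∀ {y ys} → Lex _<ₐ_ [] (y ∷ ys)
  head<    : ∀ {x y xs ys} → x <ₐ y → Lex _<ₐ_ (x ∷ xs) (y ∷ ys)
  tail<    : ∀ {x xs ys} → Lex _<ₐ_ xs ys → Lex _<ₐ_ (x ∷ xs) (x ∷ ys)

CharAt : {A : Set} → List A → ℕ → A → Set
CharAt S k c = ∃ λ rest → drop k S ≡ c ∷ rest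

Suf : {A : Set} → List A → ℕ → List A
Suf S i = drop i S

Lyndon : {A : Set} (_<ₐ_ : Rel A 0ℓ) → List A → Set
Lyndon _<ₐ_ w = 0 < length w × (∀ k → 0 < k → k < length w → Lex _<ₐ_ w (drop k w))

IsLyndonPrefix : {A : Set} (_<ₐ_ : Rel A 0ℓ) → List A → ℕ → List A → Set
IsLyndonPrefix _<ₐ_ S j w =
  ∃ λ ℓ → ℓ ≤ length (Suf S j) × w ≡ take ℓ (Suf S j) × Lyndon _<ₐ_ w ×
    (∀ ℓ' → ℓ' ≤ length (Suf S j) → Lyndon _<ₐ_ (take ℓ' (Suf S j)) → ℓ' ≤ ℓ)

NssIs : {A : Set} (_<ₐ_ : Rel A 0ℓ) → List A → ℕ → ℕ → Set
NssIs _<ₐ_ S j i =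
  j < i × i ≤ length S × Lex _<ₐ_ (Suf S i) (Suf S j) ×
  (∀ k → j < k → k < i → ¬ Lex _<ₐ_ (Suf S k) (Suf S j))

-- j ∈ P_i : j ∈ {0,…,i-1} and nss[j] = i  (requires j < n so nss[j] is defined)
InP : {A : Set} (_<ₐ_ : Rel A 0ℓ) → List A → ℕ → ℕ → Set
InP _<ₐ_ S i j = j < i × j < length S × NssIs _<ₐ_ S j i

-- If j < j' both have next smaller suffix i, then S[j..i) is a Lyndon word,
-- so L_j reaches past j'. Were L_j = L_j', the word L_j would coincide
-- with its own shift by j' − j, i.e. have a non-trivial border; Lyndon
-- words are unbordered.
module Submission where

open import Defs
open import Level using (0ℓ)
open import Data.Nat using (_<_; _≤_; _∸_; zero; suc; _+_; s≤s)
open import Data.Nat.Properties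
open import Data.List using (List; length; []; _∷_; take; drop)
open import Data.List.Properties using (take-drop; drop-drop; take-take; length-take; length-drop)
open import Data.Product using (_×_; _,_)
open import Data.Sum using (_⊎_; inj₁; inj₂)
open import Data.Empty using (⊥-elim)
open import Relation.Nullary using (¬_)
open import Relation.Binary.Core using (Rel)
open import Relation.Binary.Definitions using (tri<; tri≈; tri>)
open import Relation.Binary.Structures using (IsStrictTotalOrder)
open import Relation.Binary.PropositionalEquality
  using (_≡_; _≢_; refl; sym; trans; cong; subst; module ≡-Reasoning)

module _ {A : Set} where

  length-take-≤ : ∀ {m} {x : List A} → m ≤ length x → length (take m x) ≡ m
  length-take-≤ {m} {x} m≤ = trans (length-take m x) (m≤n⇒m⊓n≡m m≤)

  drop-≢ : ∀ {k} (x : List A) → 0 < k → k ≤ length x → drop k x ≢ x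
  drop-≢ {k} x 0<k k≤ e =
    <-irrefl (trans (sym (length-drop k x)) (cong length e)) (∸-monoʳ-< 0<k k≤)

  drop-take-≤ : ∀ {d ℓ} (x : List A) → d ≤ ℓ → drop d (take ℓ x) ≡ take (ℓ ∸ d) (drop d x)
  drop-take-≤ {d} {ℓ} x d≤ℓ = begin
    drop d (take ℓ x)             ≡⟨ cong (λ n → drop d (take n x)) (sym (m+[n∸m]≡n d≤ℓ)) ⟩
    drop d (take (d + (ℓ ∸ d)) x) ≡⟨ sym (take-drop (ℓ ∸ d) d x) ⟩
    take (ℓ ∸ d) (drop d x)       ∎
    where open ≡-Reasoning

  take-take-≤ : ∀ {m n} (x : List A) → m ≤ n → take m (take n x) ≡ take m x
  take-take-≤ {m} {n} x m≤n = trans (take-take m n x) (cong (λ k → take k x) (m≤n⇒m⊓n≡m m≤n))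

module _ {A : Set} {_<ₐ_ : Rel A 0ℓ} (sto : IsStrictTotalOrder _≡_ _<ₐ_) where
  open IsStrictTotalOrder sto using (compare) renaming (trans to <ₐ-trans; irrefl to <ₐ-irrefl)

  _≺_ : Rel (List A) 0ℓ
  _≺_ = Lex _<ₐ_

  ≺-irrefl : ∀ {x} → ¬ x ≺ x
  ≺-irrefl (head< p) = <ₐ-irrefl refl p
  ≺-irrefl (tail< l) = ≺-irrefl l

  ≺-trans : ∀ {x y z} → x ≺ y → y ≺ z → x ≺ z
  ≺-trans nil<cons  (head< _) = nil<cons
  ≺-trans nil<cons  (tail< _) = nil<cons
  ≺-trans (head< p) (head< q) = head< (<ₐ-trans p q)
  ≺-trans (head< p) (tail< _) = head< p
  ≺-trans (tail< _) (head< q) = head< q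
  ≺-trans (tail< p) (tail< q) = tail< (≺-trans p q)

  ≺-trichotomy : ∀ x y → x ≺ y ⊎ x ≡ y ⊎ y ≺ x
  ≺-trichotomy []       []       = inj₂ (inj₁ refl)
  ≺-trichotomy []       (_ ∷ _)  = inj₁ nil<cons
  ≺-trichotomy (_ ∷ _)  []       = inj₂ (inj₂ nil<cons)
  ≺-trichotomy (a ∷ x) (b ∷ y) with compare a b
  ... | tri< a<b _ _ = inj₁ (head< a<b)
  ... | tri> _ _ b<a = inj₂ (inj₂ (head< b<a))
  ... | tri≈ _ refl _ with ≺-trichotomy x y
  ...   | inj₁ x≺y        = inj₁ (tail< x≺y)
  ...   | inj₂ (inj₁ refl) = inj₂ (inj₁ refl)
  ...   | inj₂ (inj₂ y≺x) = inj₂ (inj₂ (tail< y≺x))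

  ¬≺-take : ∀ x t → ¬ x ≺ take t x
  ¬≺-take (a ∷ x) (suc t) (head< a<a) = <ₐ-irrefl refl a<a
  ¬≺-take (a ∷ x) (suc t) (tail< l)   = ¬≺-take x t l

  -- The first case is when x and y agree on their first t letters.
  ≺-split : ∀ {x y} → x ≺ y → ∀ t →
    drop t x ≺ drop t y ⊎ (∀ s → t ≤ s → take s x ≺ take t y)
  ≺-split l zero = inj₁ l
  ≺-split nil<cons  (suc t) = inj₂ λ { (suc s) (s≤s _) → nil<cons }
  ≺-split (head< p) (suc t) = inj₂ λ { (suc s) (s≤s _) → head< p }
  ≺-split (tail< l) (suc t) with ≺-split l t
  ... | inj₁ l′ = inj₁ l′
  ... | inj₂ f  = inj₂ λ { (suc s) (s≤s s≥t) → tail< (f s s≥t) }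

  Lyndon-unbordered : ∀ {w d} → Lyndon _<ₐ_ w → 0 < d → d < length w →
    drop d w ≢ take (length w ∸ d) w
  Lyndon-unbordered {w} {d} (_ , w≺suffixes) 0<d d<∣w∣ border =
    ¬≺-take w (length w ∸ d) (subst (w ≺_) border (w≺suffixes d 0<d d<∣w∣))

  smaller-suffix⇒Lyndon-take : ∀ (x : List A) m → 0 < m → m ≤ length x →
    drop m x ≺ x → (∀ k → 0 < k → k < m → ¬ drop k x ≺ x) → Lyndon _<ₐ_ (take m x)
  smaller-suffix⇒Lyndon-take x m 0<m m≤∣x∣ drop-m≺x no-smaller =
    subst (0 <_) (sym ∣take-m∣) 0<m , take-m≺suffix
    where
    ∣take-m∣ : length (take m x) ≡ m
    ∣take-m∣ = length-take-≤ m≤∣x∣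

    x≺drop : ∀ k → 0 < k → k < m → x ≺ drop k x
    x≺drop k 0<k k<m with ≺-trichotomy (drop k x) x
    ... | inj₁ drop≺x       = ⊥-elim (no-smaller k 0<k k<m drop≺x)
    ... | inj₂ (inj₁ drop≡x) = ⊥-elim (drop-≢ x 0<k (≤-trans (<⇒≤ k<m) m≤∣x∣) drop≡x)
    ... | inj₂ (inj₂ x≺drop) = x≺drop

    -- Comparing x with its suffix from k over the remaining m ∸ k letters:
    -- a difference after them would give drop (m ∸ k) x ≺ drop m x ≺ x.
    take-m≺suffix : ∀ k → 0 < k → k < length (take m x) → take m x ≺ drop k (take m x)
    take-m≺suffix k 0<k k<∣take-m∣ with subst (k <_) ∣take-m∣ k<∣take-m∣
    ... | k<m with ≺-split (x≺drop k 0<k k<m) (m ∸ k)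
    ...   | inj₂ prefix≺ =
      subst (take m x ≺_) (sym (drop-take-≤ x (<⇒≤ k<m))) (prefix≺ m (m∸n≤m m k))
    ...   | inj₁ suffix≺ = ⊥-elim (≺-irrefl (≺-trans (x≺drop (m ∸ k) (m<n⇒0<n∸m k<m) m∸k<m)
                                              (≺-trans drop-m∸k≺drop-m drop-m≺x)))
      where
      m∸k<m : m ∸ k < m
      m∸k<m = ∸-monoʳ-< 0<k (<⇒≤ k<m)
      drop-m∸k≺drop-m : drop (m ∸ k) x ≺ drop m x
      drop-m∸k≺drop-m = subst (drop (m ∸ k) x ≺_)
        (trans (drop-drop k (m ∸ k) x) (cong (λ n → drop n x) (m+[n∸m]≡n (<⇒≤ k<m)))) suffix≺

  module _ (S : List A) where

    Suf-+ : ∀ j k → drop k (Suf S j) ≡ Suf S (j + k)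
    Suf-+ j k = drop-drop j k S

    Suf-shift : ∀ {j j′} → j ≤ j′ → drop (j′ ∸ j) (Suf S j) ≡ Suf S j′
    Suf-shift {j} j≤j′ = trans (Suf-+ j _) (cong (Suf S) (m+[n∸m]≡n j≤j′))

    nss-∸-≤ : ∀ j i → NssIs _<ₐ_ S j i → i ∸ j ≤ length (Suf S j)
    nss-∸-≤ j i (_ , i≤n , _) = subst (i ∸ j ≤_) (sym (length-drop j S)) (∸-monoˡ-≤ j i≤n)

    nss⇒Lyndon : ∀ j i → NssIs _<ₐ_ S j i → Lyndon _<ₐ_ (take (i ∸ j) (Suf S j))
    nss⇒Lyndon j i nss@(j<i , _ , Sᵢ≺Sⱼ , none-smaller) =
      smaller-suffix⇒Lyndon-take (Suf S j) (i ∸ j) (m<n⇒0<n∸m j<i) (nss-∸-≤ j i nss)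
        (subst (_≺ Suf S j) (sym (Suf-shift (<⇒≤ j<i))) Sᵢ≺Sⱼ)
        (λ k 0<k k<i∸j Sⱼ₊ₖ≺Sⱼ → none-smaller (j + k) (m<m+n j 0<k)
          (subst (j + k <_) (m+[n∸m]≡n (<⇒≤ j<i)) (+-monoʳ-< j k<i∸j))
          (subst (_≺ Suf S j) (Suf-+ j k) Sⱼ₊ₖ≺Sⱼ))

    IsLyndonPrefix⇒take : ∀ j {w} → IsLyndonPrefix _<ₐ_ S j w → w ≡ take (length w) (Suf S j)
    IsLyndonPrefix⇒take j (ℓ , ℓ≤ , refl , _) =
      cong (λ n → take n (Suf S j)) (sym (length-take-≤ ℓ≤))

    IsLyndonPrefix-maximal : ∀ j {w m} → IsLyndonPrefix _<ₐ_ S j w →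
      m ≤ length (Suf S j) → Lyndon _<ₐ_ (take m (Suf S j)) → m ≤ length w
    IsLyndonPrefix-maximal _ (ℓ , ℓ≤ , refl , _ , longest) m≤ ly =
      subst (_ ≤_) (sym (length-take-≤ ℓ≤)) (longest _ m≤ ly)

    IsLyndonPrefix-unique : ∀ j {w w′} →
      IsLyndonPrefix _<ₐ_ S j w → IsLyndonPrefix _<ₐ_ S j w′ → w ≡ w′
    IsLyndonPrefix-unique j (ℓ , ℓ≤ , refl , lyw , longest) (ℓ′ , ℓ′≤ , refl , lyw′ , longest′) =
      cong (λ n → take n (Suf S j)) (≤-antisym (longest′ ℓ ℓ≤ lyw) (longest ℓ′ ℓ′≤ lyw′))

    Lyndon-prefix-≢-before-nss : ∀ i j j′ {w} → j < j′ → j′ < i → NssIs _<ₐ_ S j i →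
      IsLyndonPrefix _<ₐ_ S j w → ¬ IsLyndonPrefix _<ₐ_ S j′ w
    Lyndon-prefix-≢-before-nss i j j′ {w} j<j′ j′<i nss lw@(_ , _ , _ , lyw , _) lw′ =
      Lyndon-unbordered lyw (m<n⇒0<n∸m j<j′) d<∣w∣ border
      where
      x = Suf S j
      d = j′ ∸ j
      ℓ = length w

      d<∣w∣ : d < ℓ
      d<∣w∣ = <-≤-trans (∸-monoˡ-< j′<i (<⇒≤ j<j′))
                        (IsLyndonPrefix-maximal j lw (nss-∸-≤ j i nss) (nss⇒Lyndon j i nss))

      border : drop d w ≡ take (ℓ ∸ d) w
      border = begin
        drop d w                             ≡⟨ cong (drop d) (IsLyndonPrefix⇒take j lw) ⟩
        drop d (take ℓ x)                    ≡⟨ drop-take-≤ x (<⇒≤ d<∣w∣) ⟩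
        take (ℓ ∸ d) (drop d x)              ≡⟨ sym (take-take-≤ (drop d x) (m∸n≤m ℓ d)) ⟩
        take (ℓ ∸ d) (take ℓ (drop d x))     ≡⟨ cong (λ y → take (ℓ ∸ d) (take ℓ y)) (Suf-shift (<⇒≤ j<j′)) ⟩
        take (ℓ ∸ d) (take ℓ (Suf S j′))     ≡⟨ cong (take (ℓ ∸ d)) (sym (IsLyndonPrefix⇒take j′ lw′)) ⟩
        take (ℓ ∸ d) w                       ∎
        where open ≡-Reasoning

lemma1 : {A : Set} (_<ₐ_ : Rel A 0ℓ) → IsStrictTotalOrder _≡_ _<ₐ_ →
    (dollar : A) (S : List A) →
    1 < length S →
    CharAt S (length S ∸ 1) dollar →
    (∀ k c → k < length S ∸ 1 → CharAt S k c → dollar <ₐ c) →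
    ∀ i → i ≤ length S → ∀ j j' → InP _<ₐ_ S i j → InP _<ₐ_ S i j' →
    ∀ w w' → IsLyndonPrefix _<ₐ_ S j w → IsLyndonPrefix _<ₐ_ S j' w' →
    ((w ≢ w' → j ≢ j') × (j ≢ j' → w ≢ w'))
lemma1 _<ₐ_ sto _ S _ _ _ i _ j j′ (j<i , _ , nssⱼ) (j′<i , _ , nssⱼ′) w w′ lw lw′ =
  different-prefix⇒different-index , different-index⇒different-prefix
  where
  different-prefix⇒different-index : w ≢ w′ → j ≢ j′
  different-prefix⇒different-index w≢w′ refl = w≢w′ (IsLyndonPrefix-unique sto S j lw lw′)

  different-index⇒different-prefix : j ≢ j′ → w ≢ w′
  different-index⇒different-prefix j≢j′ refl with <-cmp j j′
  ... | tri< j<j′ _ _ = Lyndon-prefix-≢-before-nss sto S i j j′ j<j′ j′<i nssⱼ lw lw′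
  ... | tri≈ _ j≡j′ _ = j≢j′ j≡j′
  ... | tri> _ _ j′<j = Lyndon-prefix-≢-before-nss sto S i j′ j j′<j j<i nssⱼ′ lw′ lw
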